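{- There exists a polynomial-time computable mapping $f$ from PDL-formulas to variable-free PDL-formulas such that for every PDL-formula $\varphi$, $\varphi\in\mathbf{PDL}$ (i.e. $\varphi$ is valid) if and only if $f(\varphi)\in\mathbf{PDL}$.
   Context: PDL (regular propositional dynamic logic, without test): formulas and program terms are defined by $\varphi ::= p \mid \bot \mid (\varphi\to\varphi)\mid [\alpha]\varphi$ and $\alpha ::= a \mid (\alpha;\alpha)\mid(\alpha\cup\alpha)\mid\alpha^*$, where $p$ ranges over a countable set of propositional variables and $a$ over a countable set of atomic program terms. A Kripke model is $\mathfrak{M}=(S,\{R_a\}_a,V)$ with $S$ nonempty, $R_a\subseteq S\times S$, $V$ mapping variables to subsets of $S$. $R_{\alpha;\beta}$ is relational composition; $R_{\alpha\cup\beta}=R_\alpha\cup R_\beta$; $R_{\alpha^*}$ is the reflexive transitive closure of $R_\alpha$; $\mathfrak{M},s\models p$ iff $s\in V(p)$; $\bot$ never true; $\to$ classical; $\mathfrak{M},s\models[\alpha]\varphi$ iff $\varphi$ holds at all $t$ with $(s,t)\in R_\alpha$. A formula is valid if true at every state of every model; $\mathbf{PDL}$ is the set of valid formulas. A formula is variable-free if it contains no propositional variables. -}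

module Defs where

open import Data.Nat using (ℕ; zero; suc; _*_; _^_)
open import Data.Nat.Binary.Base using (ℕᵇ; 2[1+_]; 1+[2_]) renaming (zero to zeroᵇ; fromℕ to toℕᵇ)
open import Data.Fin using (Fin)
open import Data.List using (List; []; _∷_; _++_; map; length)
open import Data.Maybe using (Maybe; just; nothing)
open import Data.Product using (Σ; _×_; _,_; ∃)
open import Data.Sum using (_⊎_)
open import Data.Bool using (Bool; true)
open import Data.Empty using (⊥)
open import Data.Unit using (⊤)
open import Relation.Binary.PropositionalEquality using (_≡_)
open import Relation.Binary.Construct.Closure.ReflexiveTransitive using (Star)

data Prog : Set where
  atom : ℕ → Prog
  _⨾_  : Prog → Prog → Prog
  _∪_  : Prog → Prog → Prog
  _⋆   : Prog → Prog

data Fm : Set where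
  var  : ℕ → Fm
  ⊥̇    : Fm
  _⇒_  : Fm → Fm → Fm
  [_]_ : Prog → Fm → Fm

VarFree : Fm → Set
VarFree (var _)   = ⊥
VarFree ⊥̇         = ⊤
VarFree (φ ⇒ ψ)   = VarFree φ × VarFree ψ
VarFree ([ α ] φ) = VarFree φ

record Model : Set₁ where
  field
    S   : Set
    s₀  : S                      -- S is nonempty
    Rel : ℕ → S → S → Set
    V   : ℕ → S → Bool

open Model public

R : (M : Model) → Prog → S M → S M → Set
R M (atom a) s t = Rel M a s t
R M (α ⨾ β)  s t = Σ (S M) λ u → R M α s u × R M β u t
R M (α ∪ β)  s t = R M α s t ⊎ R M β s t
R M (α ⋆)    s t = Star (R M α) s t

_,_⊨_ : (M : Model) → S M → Fm → Set
M , s ⊨ var p     = V M p s ≡ true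
M , s ⊨ ⊥̇         = ⊥
M , s ⊨ (φ ⇒ ψ)   = M , s ⊨ φ → M , s ⊨ ψ
M , s ⊨ ([ α ] φ) = ∀ t → R M α s t → M , t ⊨ φ

Valid : Fm → Set₁
Valid φ = (M : Model) (s : S M) → M , s ⊨ φ

-- Encoding of formulas as words (Polish prefix notation; indices of
-- variables/atomic programs in bijective base-2 with digits D1, D2)

data Sym : Set where
  P A BOT IMP BOX SEQ CUP STAR D1 D2 : Sym

digits : ℕᵇ → List Sym
digits zeroᵇ    = []
digits 1+[2 x ] = D1 ∷ digits x
digits 2[1+ x ] = D2 ∷ digits x

encP : Prog → List Sym
encP (atom a) = A ∷ digits (toℕᵇ a)
encP (α ⨾ β)  = SEQ ∷ encP α ++ encP β
encP (α ∪ β)  = CUP ∷ encP α ++ encP β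
encP (α ⋆)    = STAR ∷ encP α

enc : Fm → List Sym
enc (var p)   = P ∷ digits (toℕᵇ p)
enc ⊥̇         = BOT ∷ []
enc (φ ⇒ ψ)   = IMP ∷ enc φ ++ enc ψ
enc ([ α ] φ) = BOX ∷ encP α ++ enc φ

data Cell (k : ℕ) : Set where
  blank : Cell k
  sym   : Sym → Cell k
  work  : Fin k → Cell k

data Move : Set where
  L Rt N : Move

record TM : Set where
  field
    nStates : ℕ                  -- states Fin (suc nStates), start state zero
    nWork   : ℕ
    δ : Fin (suc nStates) → Cell nWork →
        Maybe (Fin (suc nStates) × Cell nWork × Move)   -- nothing = halt

record Config (M : TM) : Set where
  constructor ⟨_,_,_,_⟩
  field
    state : Fin (suc (TM.nStates M))
    left  : List (Cell (TM.nWork M))    -- cells left of the head, nearest first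
    head  : Cell (TM.nWork M)
    right : List (Cell (TM.nWork M))

module _ (M : TM) where
  private
    C = Cell (TM.nWork M)

  moveTo : Fin (suc (TM.nStates M)) → List C → C → List C → Move → Config M
  moveTo q l       c r        N  = ⟨ q , l , c , r ⟩
  moveTo q []      c r        L  = ⟨ q , [] , c , r ⟩
  moveTo q (x ∷ l) c r        L  = ⟨ q , l , x , c ∷ r ⟩
  moveTo q l       c []       Rt = ⟨ q , c ∷ l , blank , [] ⟩
  moveTo q l       c (x ∷ r)  Rt = ⟨ q , c ∷ l , x , r ⟩

  step : Config M → Maybe (Config M)
  step ⟨ q , l , c , r ⟩ with TM.δ M q c
  ... | nothing              = nothing
  ... | just (q' , c' , mv)  = just (moveTo q' l c' r mv)

  -- runFor n c ≡ just c' : started in c, the machine halts in configuration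
  -- c' after at most n steps
  runFor : ℕ → Config M → Maybe (Config M)
  runFor n c with step c
  runFor n       c | nothing = just c
  runFor zero    c | just _  = nothing
  runFor (suc n) c | just c' = runFor n c'

  initial : List Sym → Config M
  initial []       = ⟨ Fin.zero , [] , blank , [] ⟩
  initial (x ∷ xs) = ⟨ Fin.zero , [] , sym x , map sym xs ⟩

  readSyms : List C → List Sym
  readSyms []            = []
  readSyms (sym x ∷ cs)  = x ∷ readSyms cs
  readSyms (blank ∷ _)   = []
  readSyms (work _ ∷ _)  = []

  output : Config M → List Sym
  output ⟨ _ , _ , c , r ⟩ = readSyms (c ∷ r)

PolyTime : (Fm → Fm) → Set
PolyTime f =
  Σ TM λ M → Σ ℕ λ c → Σ ℕ λ k → ∀ φ →
    Σ (Config M) λ cf →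
      (runFor M (c * suc (length (enc φ)) ^ k) (initial M (enc φ)) ≡ just cf)
      × (output M cf ≡ enc (f φ))

module Submission where

-- The reduction tr replaces each variable p by [b]⊥ for a fresh atomic
-- program b (index 2p+2) and renames each atomic program a to 2a+1.
--  * Valid (tr φ) → Valid φ: in a model, let b be the test "p is false"
--    (module WithTests).
--  * Valid φ → Valid (tr φ): from a model K build a model whose states carry
--    a valuation recording where the formulas [b]⊥ hold (module
--    WithValuations).  Such valuations exist only up to double negation,
--    which suffices because translated formulas are ¬¬-stable.
-- On encodings, tr is computed by a two-state sequential transducer (the
-- renamer, proved correct in RenamerCorrectness).

open import Defs
open import Data.Bool using (Bool; true; false; if_then_else_)
open import Data.Empty using (⊥; ⊥-elim)
open import Data.Fin using (Fin; zero; suc)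
open import Data.Fin.Patterns using (0F; 1F; 2F; 3F; 4F; 5F; 6F; 7F; 8F; 9F)
open import Data.Fin.Permutation using (transpose)
import Data.Fin.Permutation.Components as PermComponents
open import Data.Fin.Properties using (+↔⊎; *↔×; 1↔⊤)
open import Data.List using (List; []; _∷_; _++_; length; map; replicate; reverse; _ʳ++_)
open import Data.List.Properties
  using (++-assoc; ++-identityʳ; map-++; ++-ʳ++; ʳ++-defn; ʳ++-ʳ++; reverse-map; length-reverse; length-++; ∷-injective)
import Data.Maybe as Maybe
open import Data.Maybe using (Maybe; just; nothing)
open import Data.Nat using (ℕ; zero; suc; _+_; _*_; _^_; _<_; _≤_; _⊔_; z≤n; s≤s)
open import Data.Nat.Properties
  using (_≟_; ≤-refl; ≤-trans; ≤-reflexive; m≤m⊔n; m≤n⊔m; ≤∧≢⇒<; m≤n⇒m≤1+n; m≤m+n; m≤n+m; m≤n⇒m≤o+n;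
         +-identityʳ; +-monoˡ-≤; *-monoʳ-≤; module ≤-Reasoning)
import Data.Nat.Binary.Base as ℕᵇ
open import Data.Nat.Binary.Base using (2[1+_]; 1+[2_]) renaming (fromℕ to toℕᵇ)
open import Data.Nat.Binary.Properties using (fromℕ-toℕ; toℕ-fromℕ)
open import Data.Nat.Tactic.RingSolver using (solve-∀)
open import Data.Product using (Σ; _×_; _,_; proj₁; proj₂)
open import Data.Product.Function.NonDependent.Propositional using (_×-↔_)
open import Data.Sum using (_⊎_; inj₁; inj₂)
open import Data.Sum.Function.Propositional using (_⊎-↔_)
open import Data.Unit using (⊤; tt)
open import Effect.Monad using (RawMonad)
open import Function.Base using (_∘_)
open import Function.Bundles using (_⇔_; mk⇔; Equivalence; _↔_; mk↔ₛ′; Inverse)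
open import Function.Properties.Inverse using (↔-trans; ↔-sym)
open import Level using (0ℓ)
open import Relation.Binary.Construct.Closure.ReflexiveTransitive using (ε; _◅_) renaming (map to Star-map)
open import Relation.Binary.PropositionalEquality
  using (_≡_; _≢_; refl; cong; cong₂; subst; trans; module ≡-Reasoning) renaming (sym to ≡-sym)
open import Relation.Nullary using (¬_; Dec; yes; no)
open import Relation.Nullary.Decidable using (¬¬-excluded-middle)
open import Relation.Nullary.Negation using (Stable; ¬¬-Monad; contradiction)

open RawMonad (¬¬-Monad {a = 0ℓ}) using (_>>=_; return)

-- Atomic program a is renamed to 2a+1 and the variable p is replaced by
-- [2p+2]⊥.  The codes are formed in bijective binary, the notation used by enc.
atomCode varCode : ℕ → ℕ
atomCode a = ℕᵇ.toℕ 1+[2 toℕᵇ a ]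
varCode  p = ℕᵇ.toℕ 2[1+ toℕᵇ p ]

trP : Prog → Prog
trP (atom a) = atom (atomCode a)
trP (α ⨾ β)  = trP α ⨾ trP β
trP (α ∪ β)  = trP α ∪ trP β
trP (α ⋆)    = trP α ⋆

tr : Fm → Fm
tr (var p)   = [ atom (varCode p) ] ⊥̇
tr ⊥̇         = ⊥̇
tr (φ ⇒ ψ)   = tr φ ⇒ tr ψ
tr ([ α ] φ) = [ trP α ] tr φ

tr-varFree : ∀ φ → VarFree (tr φ)
tr-varFree (var p)   = tt
tr-varFree ⊥̇         = tt
tr-varFree (φ ⇒ ψ)   = tr-varFree φ , tr-varFree ψ
tr-varFree ([ α ] φ) = tr-varFree φ

-- The role an atomic program index plays in translated formulas: odd
-- indices are renamed programs, even positive ones stand for variables.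
data Role : Set where
  renamed negTest : ℕ → Role
  unused           : Role

roleOf : ℕ → Role
roleOf k with toℕᵇ k
... | ℕᵇ.zero   = unused
... | 1+[2 x ]  = renamed (ℕᵇ.toℕ x)
... | 2[1+ x ]  = negTest (ℕᵇ.toℕ x)

roleOf-atomCode : ∀ a → roleOf (atomCode a) ≡ renamed a
roleOf-atomCode a rewrite fromℕ-toℕ 1+[2 toℕᵇ a ] | toℕ-fromℕ a = refl

roleOf-varCode : ∀ p → roleOf (varCode p) ≡ negTest p
roleOf-varCode p rewrite fromℕ-toℕ 2[1+ toℕᵇ p ] | toℕ-fromℕ p = refl

-- Translated formulas are built from the negative atoms [b]⊥, so they are
-- ¬¬-stable; this lets the completeness direction reason classically.
tr-stable : ∀ M s φ → Stable (M , s ⊨ tr φ)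
tr-stable M s (var p)   h t r = h (λ k → k t r)
tr-stable M s ⊥̇         h     = h (λ x → x)
tr-stable M s (φ ⇒ ψ)   h a   = tr-stable M s ψ (λ k → h (λ g → k (g a)))
tr-stable M s ([ α ] φ) h t r = tr-stable M t φ (λ k → h (λ g → k (g t r)))

-- From validity of tr φ to validity of φ: in any model M, let the program
-- 2a+1 act as a and the program 2p+2 be the test "p is false".
module WithTests (M : Model) where

  RelOf : Role → S M → S M → Set
  RelOf (renamed a) s t = Rel M a s t
  RelOf (negTest p) s t = (s ≡ t) × (V M p s ≡ false)
  RelOf unused      s t = ⊥

  M⁺ : Model
  M⁺ = record { S = S M ; s₀ = s₀ M ; Rel = λ k → RelOf (roleOf k) ; V = V M }

  trP-sound : ∀ α {s t} → R M⁺ (trP α) s t → R M α s t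
  trP-complete : ∀ α {s t} → R M α s t → R M⁺ (trP α) s t
  trP-sound (atom a) {s} {t} r    = subst (λ ρ → RelOf ρ s t) (roleOf-atomCode a) r
  trP-sound (α ⨾ β) (u , r₁ , r₂) = u , trP-sound α r₁ , trP-sound β r₂
  trP-sound (α ∪ β) (inj₁ r)      = inj₁ (trP-sound α r)
  trP-sound (α ∪ β) (inj₂ r)      = inj₂ (trP-sound β r)
  trP-sound (α ⋆) rs              = Star-map (trP-sound α) rs
  trP-complete (atom a) {s} {t} r    = subst (λ ρ → RelOf ρ s t) (≡-sym (roleOf-atomCode a)) r
  trP-complete (α ⨾ β) (u , r₁ , r₂) = u , trP-complete α r₁ , trP-complete β r₂
  trP-complete (α ∪ β) (inj₁ r)      = inj₁ (trP-complete α r)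
  trP-complete (α ∪ β) (inj₂ r)      = inj₂ (trP-complete β r)
  trP-complete (α ⋆) rs              = Star-map (trP-complete α) rs

  var-test : ∀ p s → M⁺ , s ⊨ tr (var p) ⇔ V M p s ≡ true
  var-test p s = mk⇔ to from
    where
    to : M⁺ , s ⊨ tr (var p) → V M p s ≡ true
    to h with V M p s in eq
    ... | true  = refl
    ... | false = ⊥-elim (h s (subst (λ ρ → RelOf ρ s s) (≡-sym (roleOf-varCode p)) (refl , eq)))
    from : V M p s ≡ true → M⁺ , s ⊨ tr (var p)
    from h t r with subst (λ ρ → RelOf ρ s t) (roleOf-varCode p) r
    ... | refl , Vps≡false with trans (≡-sym h) Vps≡false
    ... | ()

  tr-faithful : ∀ φ s → M⁺ , s ⊨ tr φ ⇔ M , s ⊨ φ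
  tr-faithful (var p) s   = var-test p s
  tr-faithful ⊥̇ s         = mk⇔ (λ x → x) (λ x → x)
  tr-faithful (φ ⇒ ψ) s   = mk⇔ (λ h a → to (tr-faithful ψ s) (h (from (tr-faithful φ s) a)))
                                (λ h a → from (tr-faithful ψ s) (h (to (tr-faithful φ s) a)))
    where open Equivalence
  tr-faithful ([ α ] φ) s = mk⇔ (λ h t r → to (tr-faithful φ t) (h t (trP-complete α r)))
                                (λ h t r → from (tr-faithful φ t) (h t (trP-sound α r)))
    where open Equivalence

-- Finite ¬¬-choice: the first n of a family of propositions can be
-- ¬¬-decided simultaneously by a single Boolean valuation.
Decides : (ℕ → Set) → ℕ → (ℕ → Bool) → Set
Decides Pr n c = ∀ p → p < n → (c p ≡ true ⇔ Pr p)

decide : ∀ {X : Set} → Dec X → Σ Bool λ b → (b ≡ true ⇔ X)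
decide (yes a) = true , mk⇔ (λ _ → a) (λ _ → refl)
decide (no ¬a) = false , mk⇔ (λ ()) (λ a → contradiction a ¬a)

_[_≔_] : (ℕ → Bool) → ℕ → Bool → ℕ → Bool
(c [ n ≔ b ]) p with p ≟ n
... | yes _ = b
... | no _  = c p

decides-≔ : ∀ {Pr c n b} → Decides Pr n c → (b ≡ true ⇔ Pr n) → Decides Pr (suc n) (c [ n ≔ b ])
decides-≔ {n = n} hc hb p (s≤s p≤n) with p ≟ n
... | yes refl = hb
... | no p≢n   = hc p (≤∧≢⇒< p≤n p≢n)

decider-exists : (Pr : ℕ → Set) → ∀ n → ¬ ¬ Σ (ℕ → Bool) (Decides Pr n)
decider-exists Pr zero    = return ((λ _ → true) , λ _ ())
decider-exists Pr (suc n) = do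
  (c , hc) ← decider-exists Pr n
  dec ← ¬¬-excluded-middle
  let (b , hb) = decide dec
  return (c [ n ≔ b ] , decides-≔ hc hb)

VarsBelow : ℕ → Fm → Set
VarsBelow n (var p)   = p < n
VarsBelow n ⊥̇         = ⊤
VarsBelow n (φ ⇒ ψ)   = VarsBelow n φ × VarsBelow n ψ
VarsBelow n ([ α ] φ) = VarsBelow n φ

varBound : Fm → ℕ
varBound (var p)   = suc p
varBound ⊥̇         = 0
varBound (φ ⇒ ψ)   = varBound φ ⊔ varBound ψ
varBound ([ α ] φ) = varBound φ

varsBelow-mono : ∀ {m n} φ → m ≤ n → VarsBelow m φ → VarsBelow n φ
varsBelow-mono (var p)   m≤n p<m        = ≤-trans p<m m≤n
varsBelow-mono ⊥̇         m≤n _          = tt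
varsBelow-mono (φ ⇒ ψ)   m≤n (hφ , hψ)  = varsBelow-mono φ m≤n hφ , varsBelow-mono ψ m≤n hψ
varsBelow-mono ([ α ] φ) m≤n h          = varsBelow-mono φ m≤n h

varsBelow-bound : ∀ φ → VarsBelow (varBound φ) φ
varsBelow-bound (var p)   = ≤-refl
varsBelow-bound ⊥̇         = tt
varsBelow-bound (φ ⇒ ψ)   = varsBelow-mono φ (m≤m⊔n (varBound φ) (varBound ψ)) (varsBelow-bound φ)
                          , varsBelow-mono ψ (m≤n⊔m (varBound φ) (varBound ψ)) (varsBelow-bound ψ)
varsBelow-bound ([ α ] φ) = varsBelow-bound φ

-- From validity of φ to validity of tr φ: given a model K, build M⁻ whose
-- states pair a K-state t with a valuation, atomic program a following the
-- program 2a+1 of K and landing only on pairs whose valuation is correct at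
-- t, i.e. makes p true exactly where [2p+2]⊥ holds (for the p < n that
-- matter).
module WithValuations (K : Model) (n : ℕ) where

  Correct : S K → (ℕ → Bool) → Set
  Correct t = Decides (λ p → K , t ⊨ tr (var p)) n

  M⁻ : Model
  M⁻ = record
    { S   = S K × (ℕ → Bool)
    ; s₀  = s₀ K , (λ _ → true)
    ; Rel = λ a sb tc → Rel K (atomCode a) (proj₁ sb) (proj₁ tc) × Correct (proj₁ tc) (proj₂ tc)
    ; V   = λ p sb → proj₂ sb p
    }

  project : ∀ α {sb tc} → R M⁻ α sb tc → R K (trP α) (proj₁ sb) (proj₁ tc)
  project (atom a) (r , _)         = r
  project (α ⨾ β) (u , r₁ , r₂)    = proj₁ u , project α r₁ , project β r₂
  project (α ∪ β) (inj₁ r)         = inj₁ (project α r)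
  project (α ∪ β) (inj₂ r)         = inj₂ (project β r)
  project (α ⋆) ε                  = ε
  project (α ⋆) (r ◅ rs)           = project α r ◅ project (α ⋆) rs

  correct-preserved : ∀ α {s b t c} → R M⁻ α (s , b) (t , c) → Correct s b → Correct t c
  correct-preserved (atom a) (_ , hc) _      = hc
  correct-preserved (α ⨾ β) (_ , r₁ , r₂) hb = correct-preserved β r₂ (correct-preserved α r₁ hb)
  correct-preserved (α ∪ β) (inj₁ r) hb      = correct-preserved α r hb
  correct-preserved (α ∪ β) (inj₂ r) hb      = correct-preserved β r hb
  correct-preserved (α ⋆) ε hb               = hb
  correct-preserved (α ⋆) (r ◅ rs) hb        = correct-preserved (α ⋆) rs (correct-preserved α r hb)

  -- Conversely K-paths lift to M⁻-paths, up to double negation, because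
  -- correct valuations exist only ¬¬.
  lift : ∀ α {s t} b → R K (trP α) s t → Correct s b →
         ¬ ¬ Σ (ℕ → Bool) λ c → Correct t c × R M⁻ α (s , b) (t , c)
  lift (atom a) {t = t} b r _ = do
    (c , hc) ← decider-exists (λ p → K , t ⊨ tr (var p)) n
    return (c , hc , r , hc)
  lift (α ⨾ β) b (u , r₁ , r₂) hb = do
    (c , hc , q₁) ← lift α b r₁ hb
    (d , hd , q₂) ← lift β c r₂ hc
    return (d , hd , (u , c) , q₁ , q₂)
  lift (α ∪ β) b (inj₁ r) hb = do
    (c , hc , q) ← lift α b r hb
    return (c , hc , inj₁ q)
  lift (α ∪ β) b (inj₂ r) hb = do
    (c , hc , q) ← lift β b r hb
    return (c , hc , inj₂ q)
  lift (α ⋆) b ε hb = return (b , hb , ε)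
  lift (α ⋆) b (r ◅ rs) hb = do
    (c , hc , q) ← lift α b r hb
    (d , hd , qs) ← lift (α ⋆) c rs hc
    return (d , hd , q ◅ qs)

  tr-faithful : ∀ φ → VarsBelow n φ → ∀ s b → Correct s b → M⁻ , (s , b) ⊨ φ ⇔ K , s ⊨ tr φ
  tr-faithful (var p) p<n s b hb = hb p p<n
  tr-faithful ⊥̇ _ s b hb         = mk⇔ (λ x → x) (λ x → x)
  tr-faithful (φ ⇒ ψ) (hφ , hψ) s b hb =
    mk⇔ (λ h a → to (tr-faithful ψ hψ s b hb) (h (from (tr-faithful φ hφ s b hb) a)))
        (λ h a → from (tr-faithful ψ hψ s b hb) (h (to (tr-faithful φ hφ s b hb) a)))
    where open Equivalence
  tr-faithful ([ α ] φ) hφ s b hb = mk⇔ to′ from′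
    where
    open Equivalence
    to′ : M⁻ , (s , b) ⊨ ([ α ] φ) → K , s ⊨ tr ([ α ] φ)
    to′ h t r = tr-stable K t φ (do
      (c , hc , q) ← lift α b r hb
      return (to (tr-faithful φ hφ t c hc) (h (t , c) q)))
    from′ : K , s ⊨ tr ([ α ] φ) → M⁻ , (s , b) ⊨ ([ α ] φ)
    from′ h (t , c) q =
      from (tr-faithful φ hφ t c (correct-preserved α q hb)) (h t (project α q))

tr-validity : ∀ φ → Valid φ ⇔ Valid (tr φ)
tr-validity φ = mk⇔ complete sound
  where
  open Equivalence
  complete : Valid φ → Valid (tr φ)
  complete v K s = tr-stable K s φ (do
    (b , hb) ← decider-exists (λ p → K , s ⊨ tr (var p)) (varBound φ)
    return (to (tr-faithful φ (varsBelow-bound φ) s b hb) (v M⁻ (s , b))))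
    where open WithValuations K (varBound φ)
  sound : Valid (tr φ) → Valid φ
  sound v M s = to (tr-faithful φ s) (v M⁺ s)
    where open WithTests M

Finite : Set → Set
Finite X = Σ ℕ λ n → X ↔ Fin n

finite-↔ : ∀ {X Y} → X ↔ Y → Finite Y → Finite X
finite-↔ e (n , f) = n , ↔-trans e f

finite-⊤ : Finite ⊤
finite-⊤ = 1 , ↔-sym 1↔⊤

finite-⊎ : ∀ {X Y} → Finite X → Finite Y → Finite (X ⊎ Y)
finite-⊎ (m , e) (n , f) = m + n , ↔-trans (e ⊎-↔ f) (↔-sym +↔⊎)

finite-× : ∀ {X Y} → Finite X → Finite Y → Finite (X × Y)
finite-× (m , e) (n , f) = m * n , ↔-trans (e ×-↔ f) (↔-sym *↔×)

Maybe↔⊤⊎ : ∀ {X : Set} → Maybe X ↔ (⊤ ⊎ X)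
Maybe↔⊤⊎ {X} = mk↔ₛ′ to from to-from from-to
  where
  to : Maybe X → ⊤ ⊎ X
  to nothing  = inj₁ tt
  to (just x) = inj₂ x
  from : ⊤ ⊎ X → Maybe X
  from (inj₁ _) = nothing
  from (inj₂ x) = just x
  to-from : ∀ y → to (from y) ≡ y
  to-from (inj₁ _) = refl
  to-from (inj₂ _) = refl
  from-to : ∀ x → from (to x) ≡ x
  from-to nothing  = refl
  from-to (just _) = refl

finite-Maybe : ∀ {X} → Finite X → Finite (Maybe X)
finite-Maybe F = finite-↔ Maybe↔⊤⊎ (finite-⊎ finite-⊤ F)

pointed-numbering : ∀ {X} → Finite X → (x₀ : X) →
                    Σ ℕ λ m → Σ (X ↔ Fin (suc m)) λ e → Inverse.to e x₀ ≡ zero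
pointed-numbering (zero , e) x₀ with Inverse.to e x₀
... | ()
pointed-numbering (suc m , e) x₀ =
  m , ↔-trans e (transpose (Inverse.to e x₀) zero) ,
  PermComponents.transpose-inverse (Inverse.to e x₀) zero

finite-Sym : Finite Sym
finite-Sym = 10 , mk↔ₛ′ to from to-from from-to
  where
  to : Sym → Fin 10
  to P    = 0F
  to A    = 1F
  to BOT  = 2F
  to IMP  = 3F
  to BOX  = 4F
  to SEQ  = 5F
  to CUP  = 6F
  to STAR = 7F
  to D1   = 8F
  to D2   = 9F
  from : Fin 10 → Sym
  from 0F = P
  from 1F = A
  from 2F = BOT
  from 3F = IMP
  from 4F = BOX
  from 5F = SEQ
  from 6F = CUP
  from 7F = STAR
  from 8F = D1
  from 9F = D2
  to-from : ∀ i → to (from i) ≡ i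
  to-from 0F = refl
  to-from 1F = refl
  to-from 2F = refl
  to-from 3F = refl
  to-from 4F = refl
  to-from 5F = refl
  to-from 6F = refl
  to-from 7F = refl
  to-from 8F = refl
  to-from 9F = refl
  from-to : ∀ x → from (to x) ≡ x
  from-to P    = refl
  from-to A    = refl
  from-to BOT  = refl
  from-to IMP  = refl
  from-to BOX  = refl
  from-to SEQ  = refl
  from-to CUP  = refl
  from-to STAR = refl
  from-to D1   = refl
  from-to D2   = refl

record Transducer : Set₁ where
  field
    Q           : Set
    finite      : Finite Q
    start       : Q
    next        : Q → Sym → Q
    emit        : Q → Sym → List Sym
    final       : Q → List Sym
    emit-shape  : ∀ q x → Σ Sym λ y → Σ (List Sym) λ ys → emit q x ≡ y ∷ ys × length ys ≤ 3
    final-short : ∀ q → length (final q) ≤ 4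

  run : Q → List Sym → List Sym
  run q []       = final q
  run q (x ∷ xs) = emit q x ++ run (next q x) xs

-- It copies its input, renaming the
-- index of an atomic program a to 2a+1 (prefix digit D1) and turning a
-- variable p into [atom (2p+2)]⊥ (prefix BOX, then digit D2, and a ⊥ owed
-- once the digits of p are over).
data Mode : Set where
  copying : Mode
  inVar   : Mode   -- reading the index of a variable; its ⊥ is still owed

finite-Mode : Finite Mode
finite-Mode = 2 , mk↔ₛ′ to from to-from from-to
  where
  to : Mode → Fin 2
  to copying = 0F
  to inVar   = 1F
  from : Fin 2 → Mode
  from 0F = copying
  from 1F = inVar
  to-from : ∀ i → to (from i) ≡ i
  to-from 0F = refl
  to-from 1F = refl
  from-to : ∀ m → from (to m) ≡ m
  from-to copying = refl
  from-to inVar   = refl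

isDigit : Sym → Bool
isDigit D1 = true
isDigit D2 = true
isDigit _  = false

copyEmit : Sym → List Sym
copyEmit P = BOX ∷ A ∷ D2 ∷ []
copyEmit A = A ∷ D1 ∷ []
copyEmit x = x ∷ []

copyNext : Sym → Mode
copyNext P = inVar
copyNext _ = copying

copyEmit-shape : ∀ x → Σ Sym λ y → Σ (List Sym) λ ys → copyEmit x ≡ y ∷ ys × length ys ≤ 2
copyEmit-shape P    = _ , _ , refl , ≤-refl
copyEmit-shape A    = _ , _ , refl , s≤s z≤n
copyEmit-shape BOT  = _ , _ , refl , z≤n
copyEmit-shape IMP  = _ , _ , refl , z≤n
copyEmit-shape BOX  = _ , _ , refl , z≤n
copyEmit-shape SEQ  = _ , _ , refl , z≤n
copyEmit-shape CUP  = _ , _ , refl , z≤n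
copyEmit-shape STAR = _ , _ , refl , z≤n
copyEmit-shape D1   = _ , _ , refl , z≤n
copyEmit-shape D2   = _ , _ , refl , z≤n

renameNext : Mode → Sym → Mode
renameNext copying x = copyNext x
renameNext inVar   x = if isDigit x then inVar else copyNext x

renameEmit : Mode → Sym → List Sym
renameEmit copying x = copyEmit x
renameEmit inVar   x = if isDigit x then x ∷ [] else BOT ∷ copyEmit x

renameFinal : Mode → List Sym
renameFinal copying = []
renameFinal inVar   = BOT ∷ []

renameEmit-shape : ∀ q x → Σ Sym λ y → Σ (List Sym) λ ys → renameEmit q x ≡ y ∷ ys × length ys ≤ 3
renameEmit-shape copying x with copyEmit-shape x
... | y , ys , eq , short = y , ys , eq , m≤n⇒m≤1+n short
renameEmit-shape inVar x with isDigit x | copyEmit-shape x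
... | true  | _                   = x , [] , refl , z≤n
... | false | y , ys , eq , short = BOT , y ∷ ys , cong (BOT ∷_) eq , s≤s short

renamer : Transducer
renamer = record
  { Q           = Mode
  ; finite      = finite-Mode
  ; start       = copying
  ; next        = renameNext
  ; emit        = renameEmit
  ; final       = renameFinal
  ; emit-shape  = renameEmit-shape
  ; final-short = λ { copying → z≤n ; inVar → s≤s z≤n }
  }

module RenamerCorrectness where
  open Transducer renamer using (run)
  open ≡-Reasoning

  run-digits : ∀ q w r → run q (digits w ++ r) ≡ digits w ++ run q r
  run-digits q       ℕᵇ.zero   r = refl
  run-digits copying 1+[2 w ]  r = cong (D1 ∷_) (run-digits copying w r)
  run-digits copying 2[1+ w ]  r = cong (D2 ∷_) (run-digits copying w r)
  run-digits inVar   1+[2 w ]  r = cong (D1 ∷_) (run-digits inVar w r)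
  run-digits inVar   2[1+ w ]  r = cong (D2 ∷_) (run-digits inVar w r)

  Undigited : List Sym → Set
  Undigited []      = ⊤
  Undigited (x ∷ _) = isDigit x ≡ false

  undigited-++ : ∀ u {r} → Undigited u → Undigited r → Undigited (u ++ r)
  undigited-++ []      _  hr = hr
  undigited-++ (_ ∷ _) hu _  = hu

  run-close : ∀ r → Undigited r → run inVar r ≡ BOT ∷ run copying r
  run-close []      _ = refl
  run-close (x ∷ r) h rewrite h = refl

  record _⇝_ (u u′ : List Sym) : Set where
    constructor translates
    field
      in-context : ∀ r → Undigited r → run copying (u ++ r) ≡ u′ ++ run copying r
  open _⇝_

  ⇝-++ : ∀ {u u′ v v′} → u ⇝ u′ → v ⇝ v′ → Undigited v → (u ++ v) ⇝ (u′ ++ v′)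
  ⇝-++ {u} {u′} {v} {v′} hu hv hv₀ = translates λ r hr → begin
    run copying ((u ++ v) ++ r)      ≡⟨ cong (run copying) (++-assoc u v r) ⟩
    run copying (u ++ v ++ r)        ≡⟨ in-context hu (v ++ r) (undigited-++ v hv₀ hr) ⟩
    u′ ++ run copying (v ++ r)       ≡⟨ cong (u′ ++_) (in-context hv r hr) ⟩
    u′ ++ v′ ++ run copying r        ≡⟨ ≡-sym (++-assoc u′ v′ _) ⟩
    (u′ ++ v′) ++ run copying r      ∎

  ⇝-∷ : ∀ s {u u′} → (∀ w → run copying (s ∷ w) ≡ s ∷ run copying w) → u ⇝ u′ → (s ∷ u) ⇝ (s ∷ u′)
  ⇝-∷ s {u} {u′} copied hu = translates λ r hr → begin
    run copying (s ∷ u ++ r)  ≡⟨ copied (u ++ r) ⟩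
    s ∷ run copying (u ++ r)  ≡⟨ cong (s ∷_) (in-context hu r hr) ⟩
    s ∷ u′ ++ run copying r   ∎

  undigited-encP : ∀ α → Undigited (encP α)
  undigited-encP (atom _) = refl
  undigited-encP (_ ⨾ _)  = refl
  undigited-encP (_ ∪ _)  = refl
  undigited-encP (_ ⋆)    = refl

  undigited-enc : ∀ φ → Undigited (enc φ)
  undigited-enc (var _)   = refl
  undigited-enc ⊥̇         = refl
  undigited-enc (_ ⇒ _)   = refl
  undigited-enc ([ _ ] _) = refl

  digits-atomCode : ∀ a → digits (toℕᵇ (atomCode a)) ≡ D1 ∷ digits (toℕᵇ a)
  digits-atomCode a = cong digits (fromℕ-toℕ 1+[2 toℕᵇ a ])

  digits-varCode : ∀ p → digits (toℕᵇ (varCode p)) ≡ D2 ∷ digits (toℕᵇ p)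
  digits-varCode p = cong digits (fromℕ-toℕ 2[1+ toℕᵇ p ])

  encP-⇝ : ∀ α → encP α ⇝ encP (trP α)
  encP-⇝ (atom a) = translates λ r _ → begin
    A ∷ D1 ∷ run copying (digits (toℕᵇ a) ++ r)   ≡⟨ cong (λ w → A ∷ D1 ∷ w) (run-digits copying (toℕᵇ a) r) ⟩
    A ∷ (D1 ∷ digits (toℕᵇ a)) ++ run copying r   ≡⟨ cong (λ w → A ∷ w ++ run copying r) (≡-sym (digits-atomCode a)) ⟩
    A ∷ digits (toℕᵇ (atomCode a)) ++ run copying r ∎
  encP-⇝ (α ⨾ β) = ⇝-∷ SEQ (λ _ → refl) (⇝-++ (encP-⇝ α) (encP-⇝ β) (undigited-encP β))
  encP-⇝ (α ∪ β) = ⇝-∷ CUP (λ _ → refl) (⇝-++ (encP-⇝ α) (encP-⇝ β) (undigited-encP β))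
  encP-⇝ (α ⋆)   = ⇝-∷ STAR (λ _ → refl) (encP-⇝ α)

  enc-⇝ : ∀ φ → enc φ ⇝ enc (tr φ)
  enc-⇝ (var p) = translates λ r hr → begin
    BOX ∷ A ∷ D2 ∷ run inVar (digits dp ++ r)            ≡⟨ cong (λ w → BOX ∷ A ∷ D2 ∷ w) (run-digits inVar dp r) ⟩
    BOX ∷ A ∷ D2 ∷ digits dp ++ run inVar r              ≡⟨ cong (λ w → BOX ∷ A ∷ D2 ∷ digits dp ++ w) (run-close r hr) ⟩
    BOX ∷ A ∷ (D2 ∷ digits dp) ++ BOT ∷ run copying r     ≡⟨ cong (λ w → BOX ∷ A ∷ w ++ BOT ∷ run copying r) (≡-sym (digits-varCode p)) ⟩
    BOX ∷ A ∷ digits (toℕᵇ (varCode p)) ++ BOT ∷ run copying r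
      ≡⟨ cong (λ w → BOX ∷ A ∷ w) (≡-sym (++-assoc (digits (toℕᵇ (varCode p))) (BOT ∷ []) _)) ⟩
    enc (tr (var p)) ++ run copying r ∎
    where dp = toℕᵇ p
  enc-⇝ ⊥̇         = translates λ _ _ → refl
  enc-⇝ (φ ⇒ ψ)   = ⇝-∷ IMP (λ _ → refl) (⇝-++ (enc-⇝ φ) (enc-⇝ ψ) (undigited-enc ψ))
  enc-⇝ ([ α ] φ) = ⇝-∷ BOX (λ _ → refl) (⇝-++ (encP-⇝ α) (enc-⇝ φ) (undigited-enc φ))

  renamer-computes-tr : ∀ φ → run copying (enc φ) ≡ enc (tr φ)
  renamer-computes-tr φ = begin
    run copying (enc φ)         ≡⟨ cong (run copying) (≡-sym (++-identityʳ (enc φ))) ⟩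
    run copying (enc φ ++ [])   ≡⟨ in-context (enc-⇝ φ) [] tt ⟩
    enc (tr φ) ++ []            ≡⟨ ++-identityʳ (enc (tr φ)) ⟩
    enc (tr φ)                  ∎

module Runs (M : TM) where

  data _⇝[_]_ : Config M → ℕ → Config M → Set where
    done : ∀ {c n} → c ⇝[ n ] c
    _∷_  : ∀ {c d e n} → step M c ≡ just d → d ⇝[ n ] e → c ⇝[ suc n ] e

  infixr 5 _∷_
  infixr 4 _▸_

  weaken : ∀ {c d m n} → m ≤ n → c ⇝[ m ] d → c ⇝[ n ] d
  weaken _         done       = done
  weaken (s≤s m≤n) (s ∷ run) = s ∷ weaken m≤n run

  _▸_ : ∀ {c d e m n} → c ⇝[ m ] d → d ⇝[ n ] e → c ⇝[ m + n ] e
  _▸_ {m = m} done run′ = weaken (m≤n+m _ m) run′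
  (s ∷ run) ▸ run′      = s ∷ (run ▸ run′)

  cast : ∀ {c c′ d d′ m n} → c ≡ c′ → m ≡ n → d ≡ d′ → c ⇝[ m ] d → c′ ⇝[ n ] d′
  cast refl refl refl run = run

  runFor-halts : ∀ {c e n} → c ⇝[ n ] e → step M e ≡ nothing → runFor M n c ≡ just e
  runFor-halts {c} done halt with step M c
  runFor-halts {c} done refl | nothing = refl
  runFor-halts {c} (s ∷ run) halt with step M c
  runFor-halts {c} (refl ∷ run) halt | just _ = runFor-halts run halt

  readSyms-map : ∀ w → readSyms M (map sym w) ≡ w
  readSyms-map []      = refl
  readSyms-map (y ∷ w) = cong (y ∷_) (readSyms-map w)

-- Words of at most n symbols; the simulating machine keeps pending output
-- in its control state as such a word.
Word≤ : ℕ → Set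
Word≤ zero    = ⊤
Word≤ (suc n) = Maybe (Sym × Word≤ n)

finite-Word≤ : ∀ n → Finite (Word≤ n)
finite-Word≤ zero    = finite-⊤
finite-Word≤ (suc n) = finite-Maybe (finite-× finite-Sym (finite-Word≤ n))

word : ∀ {n} → Word≤ n → List Sym
word {zero}  _               = []
word {suc n} nothing         = []
word {suc n} (just (y , w))  = y ∷ word w

toWord : ∀ n → List Sym → Word≤ n
toWord zero    _        = tt
toWord (suc n) []       = nothing
toWord (suc n) (y ∷ ys) = just (y , toWord n ys)

widen : ∀ {n} → Word≤ n → Word≤ (suc n)
widen {zero}  _              = nothing
widen {suc n} nothing        = nothing
widen {suc n} (just (y , w)) = just (y , widen w)

word-widen : ∀ {n} (w : Word≤ n) → word (widen w) ≡ word w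
word-widen {zero}  _              = refl
word-widen {suc n} nothing        = refl
word-widen {suc n} (just (y , w)) = cong (y ∷_) (word-widen w)

word-toWord : ∀ n ys → length ys ≤ n → word (toWord n ys) ≡ ys
word-toWord zero    []       _         = refl
word-toWord (suc n) []       _         = refl
word-toWord (suc n) (y ∷ ys) (s≤s len) = cong (y ∷_) (word-toWord n ys len)

-- A cycle reading x with a unread
-- symbols after it, output of length b, and appended tail of length c ≤ 3
-- fits in the budget 2b + 10(a+1) + 12; the budget does not grow.
cycle-cost : ∀ a b c → c ≤ 3 →
  (1 + a) + ((1 + b) + (suc c + (b + c) + (1 + (a + 1)))) ≤ 2 * b + 10 * suc a + 12
cycle-cost a b c c≤3 = begin
  (1 + a) + ((1 + b) + (suc c + (b + c) + (1 + (a + 1)))) ≡⟨ collect a b c ⟩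
  2 * c + (2 * a + 2 * b + 5)                              ≤⟨ +-monoˡ-≤ _ (*-monoʳ-≤ 2 c≤3) ⟩
  2 * 3 + (2 * a + 2 * b + 5)                              ≤⟨ m≤m+n _ (8 * a + 11) ⟩
  2 * 3 + (2 * a + 2 * b + 5) + (8 * a + 11)              ≡⟨ regroup a b ⟩
  2 * b + 10 * suc a + 12                                  ∎
  where
  open ≤-Reasoning
  collect : ∀ a b c → (1 + a) + ((1 + b) + (suc c + (b + c) + (1 + (a + 1)))) ≡ 2 * c + (2 * a + 2 * b + 5)
  collect = solve-∀
  regroup : ∀ a b → 2 * 3 + (2 * a + 2 * b + 5) + (8 * a + 11) ≡ 2 * b + 10 * suc a + 12
  regroup = solve-∀

budget-step : ∀ a b c → c ≤ 3 → 2 * (b + suc c) + 10 * a + 12 ≤ 2 * b + 10 * suc a + 12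
budget-step a b c c≤3 = begin
  2 * (b + suc c) + 10 * a + 12   ≡⟨ collect a b c ⟩
  2 * c + (2 * b + 10 * a + 14)   ≤⟨ +-monoˡ-≤ _ (*-monoʳ-≤ 2 c≤3) ⟩
  2 * 3 + (2 * b + 10 * a + 14)   ≤⟨ m≤m+n _ 2 ⟩
  2 * 3 + (2 * b + 10 * a + 14) + 2 ≡⟨ regroup a b ⟩
  2 * b + 10 * suc a + 12         ∎
  where
  open ≤-Reasoning
  collect : ∀ a b c → 2 * (b + suc c) + 10 * a + 12 ≡ 2 * c + (2 * b + 10 * a + 14)
  collect = solve-∀
  regroup : ∀ a b → 2 * 3 + (2 * b + 10 * a + 14) + 2 ≡ 2 * b + 10 * suc a + 12
  regroup = solve-∀

finish-cost : ∀ b c → c ≤ 3 → (1 + b) + (suc c + (b + c) + 1) ≤ 2 * b + 10 * 0 + 12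
finish-cost b c c≤3 = begin
  (1 + b) + (suc c + (b + c) + 1)   ≡⟨ collect b c ⟩
  2 * c + (2 * b + 3)               ≤⟨ +-monoˡ-≤ _ (*-monoʳ-≤ 2 c≤3) ⟩
  2 * 3 + (2 * b + 3)               ≤⟨ m≤m+n _ 3 ⟩
  2 * 3 + (2 * b + 3) + 3           ≡⟨ regroup b ⟩
  2 * b + 10 * 0 + 12               ∎
  where
  open ≤-Reasoning
  collect : ∀ b c → (1 + b) + (suc c + (b + c) + 1) ≡ 2 * c + (2 * b + 3)
  collect = solve-∀
  regroup : ∀ b → 2 * 3 + (2 * b + 3) + 3 ≡ 2 * b + 10 * 0 + 12
  regroup = solve-∀

-- on an input of length n the budget is at most 12(n+1), used n+1 times
initial-budget : ∀ n → 2 * 0 + 10 * n + 12 ≤ 12 * suc n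
initial-budget n = ≤-trans (m≤m+n _ (2 * n)) (≤-reflexive (slack n))
  where
  slack : ∀ n → 2 * 0 + 10 * n + 12 + 2 * n ≡ 12 * suc n
  slack = solve-∀

total-steps : ∀ n → suc n * (12 * suc n) ≡ 12 * suc n ^ 2
total-steps = expanded
  where
  expanded : ∀ n → suc n * (12 * suc n) ≡ 12 * (suc n * (suc n * 1))
  expanded = solve-∀

-- The tape holds
--   MARK…MARK  (unread input)  SEP  (output so far).
-- In each cycle the machine marks the next input symbol x (remembering it
-- in its state), walks right past the output, appends emit q x from its
-- state, and walks back to the last MARK.
module Simulation (T : Transducer) where
  open Transducer T

  St : Set
  St = Q ⊎ (Q × Sym) ⊎ (Word≤ 4 × Maybe Q) ⊎ Maybe Q ⊎ Q ⊎ ⊤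

  -- read q: head on the next input symbol, transducer in state q
  pattern read q      = inj₁ q
  -- carry q x: moving right to the end of the output, having read x
  pattern carry q x   = inj₂ (inj₁ (q , x))
  -- write w k: appending the word w, then continue with k (halt if nothing)
  pattern write w k   = inj₂ (inj₂ (inj₁ (w , k)))
  -- rewind k: moving left over the output to SEP
  pattern rewind k    = inj₂ (inj₂ (inj₂ (inj₁ k)))
  -- retreat q: moving left over the unread input to the last MARK
  pattern retreat q   = inj₂ (inj₂ (inj₂ (inj₂ (inj₁ q))))
  pattern halted      = inj₂ (inj₂ (inj₂ (inj₂ (inj₂ tt))))

  finite-St : Finite St
  finite-St = finite-⊎ finite (finite-⊎ (finite-× finite finite-Sym)
                (finite-⊎ (finite-× (finite-Word≤ 4) (finite-Maybe finite))
                  (finite-⊎ (finite-Maybe finite) (finite-⊎ finite finite-⊤))))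

  C : Set
  C = Cell 2

  MARK SEP : C
  MARK = work zero
  SEP  = work (suc zero)

  Action : Set
  Action = Maybe (St × C × Move)

  finish : Word≤ 4 → Action
  finish nothing  = just (halted , SEP , Rt)
  finish w        = just (write w nothing , SEP , Rt)

  -- append the pending word, one symbol per step (it is never empty)
  put : Word≤ 4 → Maybe Q → Action
  put nothing                k = nothing
  put (just (y , nothing))   k = just (rewind k , sym y , L)
  put (just (y , just w))    k = just (write (widen (just w)) k , sym y , Rt)

  δ′ : St → C → Action
  δ′ (read q)        (sym x) = just (carry q x , MARK , Rt)
  δ′ (read q)        _       = finish (toWord 4 (final q))
  δ′ (carry q x)     (sym y) = just (carry q x , sym y , Rt)
  δ′ (carry q x)     _       = just (write (toWord 4 (emit q x)) (just (next q x)) , SEP , Rt)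
  δ′ (write w k)     (sym y) = just (write w k , sym y , Rt)
  δ′ (write w k)     _       = put w k
  δ′ (rewind k)      (sym y) = just (rewind k , sym y , L)
  δ′ (rewind nothing)  _     = just (halted , SEP , Rt)
  δ′ (rewind (just q)) _     = just (retreat q , SEP , L)
  δ′ (retreat q)     (sym y) = just (retreat q , sym y , L)
  δ′ (retreat q)     _       = just (read q , MARK , Rt)
  δ′ halted          _       = nothing

  -- States are numbered so that read start is state zero.  The numbering is
  -- opaque: proofs use only that it is a bijection sending read start to zero.
  opaque
    numbering : Σ ℕ λ m → Σ (St ↔ Fin (suc m)) λ e → Inverse.to e (read start) ≡ zero
    numbering = pointed-numbering finite-St (read start)

  nStates : ℕ
  nStates = proj₁ numbering

  code : St → Fin (suc nStates)
  code = Inverse.to (proj₁ (proj₂ numbering))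

  decode : Fin (suc nStates) → St
  decode = Inverse.from (proj₁ (proj₂ numbering))

  decode-code : ∀ s → decode (code s) ≡ s
  decode-code = Inverse.strictlyInverseʳ (proj₁ (proj₂ numbering))

  code-start : code (read start) ≡ zero
  code-start = proj₂ (proj₂ numbering)

  machine : TM
  machine = record
    { nStates = nStates
    ; nWork   = 2
    ; δ       = λ i c → Maybe.map (λ (s , c′ , mv) → code s , c′ , mv) (δ′ (decode i) c)
    }

  open Runs machine

  -- the head reads the first cell of r (a blank if r is empty)
  conf : St → List C → List C → Config machine
  conf s l []      = ⟨ code s , l , blank , [] ⟩
  conf s l (c ∷ r) = ⟨ code s , l , c , r ⟩

  -- the head reads the cell nearest to it on the left side l
  confˡ : St → List C → List C → Config machine
  confˡ s []      r = ⟨ code s , [] , blank , r ⟩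
  confˡ s (c ∷ l) r = ⟨ code s , l , c , r ⟩

  after : List C → List C → St × C × Move → Config machine
  after l r (s′ , c′ , mv) = moveTo machine (code s′) l c′ r mv

  step-δ′ : ∀ s l c r → step machine ⟨ code s , l , c , r ⟩ ≡ Maybe.map (after l r) (δ′ s c)
  step-δ′ s l c r rewrite decode-code s with δ′ s c
  ... | nothing = refl
  ... | just _  = refl

  step-right : ∀ {s c s′ c′} l r → δ′ s c ≡ just (s′ , c′ , Rt) →
               ⟨ code s , l , c , r ⟩ ⇝[ 1 ] conf s′ (c′ ∷ l) r
  step-right {s} {c} {s′} {c′} l r act =
    trans (trans (step-δ′ s l c r) (cong (Maybe.map (after l r)) act)) (cong just (moved r)) ∷ done
    where
    moved : ∀ r → moveTo machine (code s′) l c′ r Rt ≡ conf s′ (c′ ∷ l) r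
    moved []      = refl
    moved (_ ∷ _) = refl

  step-left : ∀ {s c s′ c′} l r → δ′ s c ≡ just (s′ , c′ , L) → l ≢ [] →
              ⟨ code s , l , c , r ⟩ ⇝[ 1 ] confˡ s′ l (c′ ∷ r)
  step-left []      r act nonempty = contradiction refl nonempty
  step-left {s} {c} (z ∷ l) r act _ =
    trans (step-δ′ s (z ∷ l) c r) (cong (Maybe.map (after (z ∷ l) r)) act) ∷ done

  ++-∷-≢[] : ∀ (us : List C) {z l} → us ++ z ∷ l ≢ []
  ++-∷-≢[] []      ()
  ++-∷-≢[] (_ ∷ _) ()

  ʳ++-∷-≢[] : ∀ (us : List C) {z l} → us ʳ++ z ∷ l ≢ []
  ʳ++-∷-≢[] us eq = ++-∷-≢[] (reverse us) (trans (≡-sym (ʳ++-defn us)) eq)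

  scan-right : ∀ s → (∀ y → δ′ s (sym y) ≡ just (s , sym y , Rt)) →
               ∀ ys l r → conf s l (map sym ys ++ r) ⇝[ length ys ] conf s (map sym ys ʳ++ l) r
  scan-right s moves []       l r = done
  scan-right s moves (y ∷ ys) l r = step-right l (map sym ys ++ r) (moves y) ▸ scan-right s moves ys (sym y ∷ l) r

  -- Likewise to the left, stopping on the first non-symbol cell z; the block
  -- ys is given in tape order, so it lies reversed in the left part.
  scan-left : ∀ s → (∀ y → δ′ s (sym y) ≡ just (s , sym y , L)) →
              ∀ ys z l r → confˡ s (map sym ys ʳ++ z ∷ l) r ⇝[ length ys ] ⟨ code s , l , z , map sym ys ++ r ⟩
  scan-left s moves ys z l r =
    cast (cong (λ us → confˡ s us r) left-part) (length-reverse ys) (cong (λ us → ⟨ code s , l , z , us ⟩) right-part)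
         (scan-nearest (reverse ys) r)
    where
    scan-nearest : ∀ vs r → confˡ s (map sym vs ++ z ∷ l) r ⇝[ length vs ] ⟨ code s , l , z , map sym vs ʳ++ r ⟩
    scan-nearest []       r = done
    scan-nearest (v ∷ vs) r = step-left (map sym vs ++ z ∷ l) r (moves v) (++-∷-≢[] (map sym vs)) ▸ scan-nearest vs (sym v ∷ r)
    left-part : map sym (reverse ys) ++ z ∷ l ≡ map sym ys ʳ++ z ∷ l
    left-part = trans (cong (_++ z ∷ l) (reverse-map sym ys)) (≡-sym (ʳ++-defn (map sym ys)))
    right-part : map sym (reverse ys) ʳ++ r ≡ map sym ys ++ r
    right-part = trans (cong (_ʳ++ r) (reverse-map sym ys)) (ʳ++-ʳ++ (map sym ys))

  marks : ℕ → List C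
  marks i = replicate i MARK

  outputZone : List Sym → List C
  outputZone []       = []
  outputZone (y ∷ ys) = SEP ∷ map sym (y ∷ ys)

  outputZone-++ : ∀ o y ys → outputZone (o ++ y ∷ ys) ≡ SEP ∷ map sym (o ++ y ∷ ys)
  outputZone-++ []      y ys = refl
  outputZone-++ (_ ∷ _) y ys = refl

  read-input : ∀ q x xs i Z →
    conf (read q) (marks i) (sym x ∷ map sym xs ++ Z) ⇝[ 1 + length xs ]
    conf (carry q x) (map sym xs ʳ++ MARK ∷ marks i) Z
  read-input q x xs i Z = step-right (marks i) _ refl ▸ scan-right (carry q x) (λ _ → refl) xs (MARK ∷ marks i) Z

  -- A state that acts alike on a blank and on SEP, writing SEP and moving
  -- right, steps onto the output (which it meets as a blank if o is empty).
  cross-SEP : ∀ s s′ → δ′ s blank ≡ just (s′ , SEP , Rt) → δ′ s SEP ≡ just (s′ , SEP , Rt) →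
    ∀ l o → conf s l (outputZone o) ⇝[ 1 ] conf s′ (SEP ∷ l) (map sym o)
  cross-SEP s s′ onBlank onSEP l []       = step-right l [] onBlank
  cross-SEP s s′ onBlank onSEP l (y ∷ ys) = step-right l (map sym (y ∷ ys)) onSEP

  to-output-end : ∀ s w k → δ′ s blank ≡ just (write w k , SEP , Rt) → δ′ s SEP ≡ just (write w k , SEP , Rt) →
    ∀ l o → conf s l (outputZone o) ⇝[ 1 + length o ] conf (write w k) (map sym o ʳ++ SEP ∷ l) []
  to-output-end s w k onBlank onSEP l o =
    cross-SEP s (write w k) onBlank onSEP l o ▸
    cast (cong (conf (write w k) (SEP ∷ l)) (++-identityʳ (map sym o))) refl refl
         (scan-right (write w k) (λ _ → refl) o (SEP ∷ l) [])

  append : ∀ k l ys y (w : Word≤ 4) o → word w ≡ y ∷ ys →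
    conf (write w k) (map sym o ʳ++ SEP ∷ l) [] ⇝[ suc (length ys) + (length o + length ys) ]
    ⟨ code (rewind k) , l , SEP , map sym (o ++ y ∷ ys) ⟩
  append k l [] y (just (.y , nothing)) o refl =
    cast refl (cong suc (≡-sym (+-identityʳ (length o)))) (cong (λ us → ⟨ code (rewind k) , l , SEP , us ⟩) (≡-sym (map-++ sym o (y ∷ []))))
      (step-left (map sym o ʳ++ SEP ∷ l) [] refl (ʳ++-∷-≢[] (map sym o)) ▸
       scan-left (rewind k) (λ _ → refl) o SEP l (sym y ∷ []))
  append k l (y₂ ∷ ys) y (just (y′ , just (y₂′ , u))) o eq with ∷-injective eq
  ... | refl , eq₂ with ∷-injective eq₂
  ... | refl , word-u =
    cast refl (written-cost (length o) (length ys))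
         (cong (λ us → ⟨ code (rewind k) , l , SEP , map sym us ⟩) (++-assoc o (y ∷ []) (y₂ ∷ ys)))
      (step-right (map sym o ʳ++ SEP ∷ l) [] refl ▸
       cast (cong (λ us → conf (write (widen (just (y₂ , u))) k) us []) written)
            (cong (λ n → suc (length ys) + (n + length ys)) (length-++ o)) refl
         (append k l ys y₂ (widen (just (y₂ , u))) (o ++ y ∷ []) (cong (y₂ ∷_) (trans (word-widen u) word-u))))
    where
    written : map sym (o ++ y ∷ []) ʳ++ SEP ∷ l ≡ sym y ∷ map sym o ʳ++ SEP ∷ l
    written = trans (cong (_ʳ++ SEP ∷ l) (map-++ sym o (y ∷ []))) (++-ʳ++ (map sym o))
    written-cost : ∀ b c → 1 + (suc c + ((b + 1) + c)) ≡ suc (suc c) + (b + suc c)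
    written-cost = solve-∀
  append k l [] y (just (y′ , just _)) o ()
  append k l (_ ∷ _) y (just (y′ , nothing)) o ()

  return-to-input : ∀ q xs i R →
    ⟨ code (rewind (just q)) , map sym xs ʳ++ MARK ∷ marks i , SEP , R ⟩ ⇝[ 1 + (length xs + 1) ]
    conf (read q) (marks (suc i)) (map sym xs ++ SEP ∷ R)
  return-to-input q xs i R =
    step-left (map sym xs ʳ++ MARK ∷ marks i) R refl (ʳ++-∷-≢[] (map sym xs)) ▸
    scan-left (retreat q) (λ _ → refl) xs MARK (marks i) (SEP ∷ R) ▸
    step-right (marks i) (map sym xs ++ SEP ∷ R) refl

  cycle : ∀ q x xs i o y ys → emit q x ≡ y ∷ ys → length ys ≤ 3 →
    conf (read q) (marks i) (map sym (x ∷ xs) ++ outputZone o)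
      ⇝[ (1 + length xs) + ((1 + length o) + (suc (length ys) + (length o + length ys) + (1 + (length xs + 1)))) ]
    conf (read (next q x)) (marks (suc i)) (map sym xs ++ outputZone (o ++ y ∷ ys))
  cycle q x xs i o y ys emits short =
    read-input q x xs i (outputZone o) ▸
    to-output-end (carry q x) w (just (next q x)) refl refl (map sym xs ʳ++ MARK ∷ marks i) o ▸
    append (just (next q x)) (map sym xs ʳ++ MARK ∷ marks i) ys y w o pending ▸
    cast refl refl (cong (λ Z → conf (read (next q x)) (marks (suc i)) (map sym xs ++ Z)) (≡-sym (outputZone-++ o y ys)))
      (return-to-input (next q x) xs i (map sym (o ++ y ∷ ys)))
    where
    w : Word≤ 4
    w = toWord 4 (emit q x)
    pending : word w ≡ y ∷ ys
    pending = trans (word-toWord 4 (emit q x) (subst (λ e → length e ≤ 4) (≡-sym emits) (s≤s short))) emits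

  finish-run : ∀ q i o → conf (read q) (marks i) (outputZone o) ⇝[ 2 * length o + 10 * 0 + 12 ]
               conf halted (SEP ∷ marks i) (map sym (o ++ final q))
  finish-run q i o with final q in ends | final-short q
  ... | [] | _ =
    weaken (m≤n⇒m≤o+n (2 * length o + 10 * 0) (s≤s z≤n))
      (cast refl refl (cong (conf halted (SEP ∷ marks i)) (cong (map sym) (≡-sym (++-identityʳ o))))
        (cross-SEP (read q) halted finishes finishes (marks i) o))
    where
    finishes : finish (toWord 4 (final q)) ≡ just (halted , SEP , Rt)
    finishes = cong (finish ∘ toWord 4) ends
  ... | y ∷ ys | s≤s short =
    weaken (finish-cost (length o) (length ys) short)
      (to-output-end (read q) w nothing appends appends (marks i) o ▸
       append nothing (marks i) ys y w o (word-toWord 4 (y ∷ ys) (s≤s short)) ▸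
       step-right (marks i) (map sym (o ++ y ∷ ys)) refl)
    where
    w : Word≤ 4
    w = toWord 4 (y ∷ ys)
    appends : finish (toWord 4 (final q)) ≡ just (write w nothing , SEP , Rt)
    appends = cong (finish ∘ toWord 4) ends

  halted-stops : ∀ l r → step machine (conf halted l r) ≡ nothing
  halted-stops l []      = step-δ′ halted l blank []
  halted-stops l (c ∷ r) = step-δ′ halted l c r

  output-conf : ∀ s l v → output machine (conf s l (map sym v)) ≡ v
  output-conf s l []      = refl
  output-conf s l (y ∷ v) = cong (y ∷_) (readSyms-map v)

  budget : List Sym → List Sym → ℕ
  budget o xs = 2 * length o + 10 * length xs + 12

  simulation : ∀ xs q i o K → budget o xs ≤ K →
    Σ (List C) λ l → conf (read q) (marks i) (map sym xs ++ outputZone o) ⇝[ suc (length xs) * K ]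
                     conf halted l (map sym (o ++ run q xs))
  simulation [] q i o K fits =
    SEP ∷ marks i , weaken (≤-trans fits (≤-reflexive (≡-sym (+-identityʳ K)))) (finish-run q i o)
  simulation (x ∷ xs) q i o K fits with emit-shape q x
  ... | y , ys , emits , short =
    let (l , rest) = simulation xs (next q x) (suc i) (o ++ y ∷ ys) K fits′ in
    l , (weaken (≤-trans (cycle-cost (length xs) (length o) (length ys) short) fits) (cycle q x xs i o y ys emits short) ▸
         cast refl refl (cong (conf halted l ∘ map sym) produced) rest)
    where
    fits′ : budget (o ++ y ∷ ys) xs ≤ K
    fits′ = ≤-trans (subst (λ n → 2 * n + 10 * length xs + 12 ≤ budget o (x ∷ xs)) (≡-sym (length-++ o))
                       (budget-step (length xs) (length o) (length ys) short)) fits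
    produced : (o ++ y ∷ ys) ++ run (next q x) xs ≡ o ++ run q (x ∷ xs)
    produced = trans (++-assoc o (y ∷ ys) _) (cong (λ e → o ++ e ++ run (next q x) xs) (≡-sym emits))

  initial-conf : ∀ w → initial machine w ≡ conf (read start) (marks 0) (map sym w ++ outputZone [])
  initial-conf []      = cong (λ i → ⟨ i , [] , blank , [] ⟩) (≡-sym code-start)
  initial-conf (x ∷ w) = cong₂ (λ i r → ⟨ i , [] , sym x , r ⟩) (≡-sym code-start) (≡-sym (++-identityʳ (map sym w)))

  simulates : ∀ w → Σ (Config machine) λ cf →
    (runFor machine (12 * suc (length w) ^ 2) (initial machine w) ≡ just cf) × (output machine cf ≡ run start w)
  simulates w =
    let (l , run-w) = simulation w start 0 [] (12 * suc (length w)) (initial-budget (length w)) in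
    conf halted l (map sym (run start w)) ,
    runFor-halts (cast (≡-sym (initial-conf w)) (total-steps (length w)) refl run-w) (halted-stops l (map sym (run start w))) ,
    output-conf halted l (run start w)

theorem3 : Σ (Fm → Fm) λ f →
    PolyTime f × (∀ φ → VarFree (f φ)) × (∀ φ → (Valid φ ⇔ Valid (f φ)))
theorem3 = tr , tr-polyTime , tr-varFree , tr-validity
  where
  open Simulation renamer using (machine; simulates)
  tr-polyTime : PolyTime tr
  tr-polyTime = machine , 12 , 2 , λ φ →
    let (cf , halts , out) = simulates (enc φ)
    in cf , halts , trans out (RenamerCorrectness.renamer-computes-tr φ)
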